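{- Let $1/2\le\varepsilon<1$ and let $\delta=1/(2-\varepsilon)$. For every cograph $G$ with at least one vertex, there is a set $X\subseteq V(G)$ with $|X|>\delta|G|$ such that one of $G[X]$, $\overline{G}[X]$ has maximum degree at most $\varepsilon\delta|G|$.
   Context: All graphs are finite and simple; $|G|$ is the number of vertices, $G[X]$ the induced subgraph on $X$, $\overline{G}$ the complement. A cograph is a graph with no induced subgraph isomorphic to $P_4$, the path on four vertices.
   Formalization: The parameter ε, and with it δ, ranges over the rationals. -}

module Defs where

open import Data.Nat using (ℕ)
open import Data.Bool using (Bool; true; false; not; _∧_)
open import Data.Fin using (Fin)
open import Data.Fin.Subset using (Subset; _∈_; _∩_; ∣_∣)
open import Data.Vec using (tabulate)
open import Data.Integer using (+_)
open import Data.Rational using (ℚ; _/_)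
open import Relation.Binary.PropositionalEquality using (_≡_; _≢_)
open import Relation.Nullary using (¬_)
open import Relation.Nullary.Decidable using (⌊_⌋)
open import Data.Fin using (_≟_)

record Graph (n : ℕ) : Set where
  field
    adj   : Fin n → Fin n → Bool
    sym   : ∀ u v → adj u v ≡ adj v u
    irrefl : ∀ v → adj v v ≡ false
open Graph public

complement : ∀ {n} → Graph n → Graph n
complement {n} G = record
  { adj = cadj
  ; sym = csym
  ; irrefl = cirr
  }
  where
  cadj : Fin n → Fin n → Bool
  cadj u v = not ⌊ u ≟ v ⌋ ∧ not (adj G u v)
  csym : ∀ u v → cadj u v ≡ cadj v u
  csym u v with u ≟ v | v ≟ u
  ... | Relation.Nullary.yes _ | Relation.Nullary.yes _ = Relation.Binary.PropositionalEquality.refl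
  ... | Relation.Nullary.no _ | Relation.Nullary.no _ =
        Relation.Binary.PropositionalEquality.cong not (Graph.sym G u v)
  ... | Relation.Nullary.yes p | Relation.Nullary.no q = Data.Empty.⊥-elim (q (Relation.Binary.PropositionalEquality.sym p))
    where import Data.Empty
  ... | Relation.Nullary.no p | Relation.Nullary.yes q = Data.Empty.⊥-elim (p (Relation.Binary.PropositionalEquality.sym q))
    where import Data.Empty
  cirr : ∀ v → cadj v v ≡ false
  cirr v with v ≟ v
  ... | Relation.Nullary.yes _ = Relation.Binary.PropositionalEquality.refl
  ... | Relation.Nullary.no p = Data.Empty.⊥-elim (p Relation.Binary.PropositionalEquality.refl)
    where import Data.Empty

InducedP4 : ∀ {n} → Graph n → Fin n → Fin n → Fin n → Fin n → Set
InducedP4 G a b c d =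
  a ≢ b × a ≢ c × a ≢ d × b ≢ c × b ≢ d × c ≢ d ×
  adj G a b ≡ true × adj G b c ≡ true × adj G c d ≡ true ×
  adj G a c ≡ false × adj G b d ≡ false × adj G a d ≡ false
  where open import Data.Product using (_×_)

IsCograph : ∀ {n} → Graph n → Set
IsCograph G = ∀ a b c d → ¬ InducedP4 G a b c d

nbhd : ∀ {n} → Graph n → Fin n → Subset n
nbhd G v = tabulate (adj G v)

degIn : ∀ {n} → Graph n → Subset n → Fin n → ℕ
degIn G X v = ∣ X ∩ nbhd G v ∣

MaxDegInducedAtMost : ∀ {n} → Graph n → Subset n → ℚ → Set
MaxDegInducedAtMost G X b = ∀ v → v ∈ X → (+ degIn G X v / 1) Data.Rational.≤ b
  where import Data.Rational

toℚ : ℕ → ℚ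
toℚ k = + k / 1

{-# OPTIONS --safe #-}

-- Every induced subgraph of a cograph on at least two vertices is disconnected or has a
-- disconnected complement: adding one vertex v at a time, v either joins a part of the current
-- split, is adjacent to everything (hence isolated in the complement), or separates its closed
-- neighbourhood from its non-neighbours, as otherwise an induced P4 appears.
--
-- Put D = ⌊εδN⌋, b = D + 1, and call a set sparse in a graph if it induces maximum degree at
-- most D. Sets of at most b vertices are sparse, and so is the union of two sparse sets with no
-- edges between them. Hence for a split S = A ∪ B in G (the complement is symmetric) either both
-- parts contain b vertices, and b from each give a G-sparse set of size 2b, or a part B of at
-- most b vertices can be added to the G-sparse set found recursively for A. This yields, for
-- every S, a G-sparse P ⊆ S and a complement-sparse Q ⊆ S with |P| + |Q| ≥ |S| + min(|S|, b),
-- or with |P| ≥ 2b or |Q| ≥ 2b. For S = V(G) one of P, Q then has more than δN vertices, since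
-- 2δN = N + εδN < N + min(N, b) and δN ≤ 2εδN < 2b as ε ≥ 1/2.

module Submission where

open import Defs
open import Data.Empty using (⊥-elim)
open import Data.Fin.Subset using (Subset; ⊤; ∣_∣)
open import Data.Fin.Subset.Properties using (∣⊤∣≡n)
open import Data.Product using (Σ; ∃; _×_; _,_)
open import Data.Sum using (_⊎_; inj₁; inj₂)
open import Relation.Nullary using (yes; no)
open import Relation.Binary.PropositionalEquality using (_≡_; refl; trans; cong₂)
import Relation.Binary.PropositionalEquality as ≡

module Combinatorics where

  open import Data.Bool using (Bool; true; false; not)
  open import Data.Bool.Properties using (¬-not; ∧-zeroʳ)
  import Data.Bool.Properties as Bool
  open import Data.Empty using (⊥)
  open import Data.Fin using (Fin; zero; suc; _≟_)
  import Data.Fin.Properties as Fin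
  open import Data.Fin.Subset using (_∈_; _∉_; _⊆_; _∪_; _∩_; ∁; _─_; _-_; ⁅_⁆; Nonempty)
    renaming (⊥ to ∅)
  open import Data.Fin.Subset.Properties
  open import Data.Nat using (ℕ; zero; suc; _+_; _≤_; _<_; _⊓_; z≤n; s≤s; _≤?_)
  open import Data.Nat.Induction using (<-wellFounded)
  import Data.Nat.Properties as ℕ
  open import Algebra.Properties.CommutativeSemigroup ℕ.+-commutativeSemigroup
    using (xy∙z≈xz∙y)
  open import Data.Product using (proj₁; proj₂)
  open import Data.Sum using ([_,_]′)
  import Data.Sum as Sum
  open import Data.Vec using ([]; _∷_; here; there; tabulate)
  import Data.Vec.Properties as Vec
  open import Function using (_∘_)
  open import Induction.WellFounded using (Acc; acc)
  open import Relation.Nullary.Decidable using (_×-dec_)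
  open import Relation.Binary.PropositionalEquality using (_≢_; cong; subst)

  ∣p∪q∣≤∣p∣+∣q∣ : ∀ {m} (p q : Subset m) → ∣ p ∪ q ∣ ≤ ∣ p ∣ + ∣ q ∣
  ∣p∪q∣≤∣p∣+∣q∣ []          []          = z≤n
  ∣p∪q∣≤∣p∣+∣q∣ (true ∷ p)  (true ∷ q)  =
    s≤s (ℕ.≤-trans (∣p∪q∣≤∣p∣+∣q∣ p q) (ℕ.+-monoʳ-≤ ∣ p ∣ (ℕ.n≤1+n ∣ q ∣)))
  ∣p∪q∣≤∣p∣+∣q∣ (true ∷ p)  (false ∷ q) = s≤s (∣p∪q∣≤∣p∣+∣q∣ p q)
  ∣p∪q∣≤∣p∣+∣q∣ (false ∷ p) (true ∷ q)  =
    subst (suc ∣ p ∪ q ∣ ≤_) (≡.sym (ℕ.+-suc ∣ p ∣ ∣ q ∣)) (s≤s (∣p∪q∣≤∣p∣+∣q∣ p q))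
  ∣p∪q∣≤∣p∣+∣q∣ (false ∷ p) (false ∷ q) = ∣p∪q∣≤∣p∣+∣q∣ p q

  ∣p∪q∣≡∣p∣+∣q∣ : ∀ {m} (p q : Subset m) → (∀ {x} → x ∈ p → x ∉ q) → ∣ p ∪ q ∣ ≡ ∣ p ∣ + ∣ q ∣
  ∣p∪q∣≡∣p∣+∣q∣ []          []          disj = refl
  ∣p∪q∣≡∣p∣+∣q∣ (true ∷ p)  (true ∷ q)  disj = ⊥-elim (disj here here)
  ∣p∪q∣≡∣p∣+∣q∣ (true ∷ p)  (false ∷ q) disj =
    cong suc (∣p∪q∣≡∣p∣+∣q∣ p q λ x∈p x∈q → disj (there x∈p) (there x∈q))
  ∣p∪q∣≡∣p∣+∣q∣ (false ∷ p) (true ∷ q)  disj =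
    trans (cong suc (∣p∪q∣≡∣p∣+∣q∣ p q λ x∈p x∈q → disj (there x∈p) (there x∈q)))
          (≡.sym (ℕ.+-suc ∣ p ∣ ∣ q ∣))
  ∣p∪q∣≡∣p∣+∣q∣ (false ∷ p) (false ∷ q) disj =
    ∣p∪q∣≡∣p∣+∣q∣ p q λ x∈p x∈q → disj (there x∈p) (there x∈q)

  ∣p∣≤∣q∣+∣r∣ : ∀ {m} {p q r : Subset m} → (∀ {x} → x ∈ p → x ∈ q ⊎ x ∈ r) → ∣ p ∣ ≤ ∣ q ∣ + ∣ r ∣
  ∣p∣≤∣q∣+∣r∣ {q = q} {r} cover =
    ℕ.≤-trans (p⊆q⇒∣p∣≤∣q∣ (λ x∈p → x∈p∪q⁺ (cover x∈p))) (∣p∪q∣≤∣p∣+∣q∣ q r)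

  ∣p∣>0⇒Nonempty : ∀ {m} (p : Subset m) → 0 < ∣ p ∣ → Nonempty p
  ∣p∣>0⇒Nonempty (true ∷ p)  _     = zero , here
  ∣p∣>0⇒Nonempty (false ∷ p) ∣p∣>0 =
    let x , x∈p = ∣p∣>0⇒Nonempty p ∣p∣>0 in suc x , there x∈p

  ∃⊆-ofSize : ∀ {m} (p : Subset m) k → k ≤ ∣ p ∣ → Σ (Subset m) λ q → q ⊆ p × ∣ q ∣ ≡ k
  ∃⊆-ofSize {m} p           zero    _ = ∅ , ⊥⊆ , ∣⊥∣≡0 m
  ∃⊆-ofSize (true ∷ p)  (suc k) (s≤s k≤∣p∣) =
    let q , q⊆p , ∣q∣≡k = ∃⊆-ofSize p k k≤∣p∣ in true ∷ q , s⊆s q⊆p , cong suc ∣q∣≡k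
  ∃⊆-ofSize (false ∷ p) (suc k) k<∣p∣ =
    let q , q⊆p , ∣q∣≡k = ∃⊆-ofSize p (suc k) k<∣p∣ in false ∷ q , s⊆s q⊆p , ∣q∣≡k

  p∪q⊆r : ∀ {m} {p q r : Subset m} → p ⊆ r → q ⊆ r → p ∪ q ⊆ r
  p∪q⊆r {p = p} {q} p⊆r q⊆r x∈p∪q = [ p⊆r , q⊆r ]′ (x∈p∪q⁻ p q x∈p∪q)

  x∈p─q⇒x∉q : ∀ {m} {x : Fin m} (p q : Subset m) → x ∈ p ─ q → x ∉ q
  x∈p─q⇒x∉q (_ ∷ p) (true ∷ q) ()          here
  x∈p─q⇒x∉q (_ ∷ p) (_ ∷ q)    (there x∈) (there x∈q) = x∈p─q⇒x∉q p q x∈ x∈q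

  x∈p-y⇒x≢y : ∀ {m} {x y : Fin m} (p : Subset m) → x ∈ p - y → x ≢ y
  x∈p-y⇒x≢y {y = y} p x∈p-y refl = x∈p─q⇒x∉q p ⁅ y ⁆ x∈p-y (x∈⁅x⁆ y)

  ∣p∣≤1⇒unique : ∀ {m} {p : Subset m} {x y} → ∣ p ∣ ≤ 1 → x ∈ p → y ∈ p → y ≡ x
  ∣p∣≤1⇒unique {p = p} {x} {y} ∣p∣≤1 x∈p y∈p with y ≟ x
  ... | yes y≡x = y≡x
  ... | no  y≢x = ⊥-elim (ℕ.<⇒≱ (ℕ.≤-<-trans 1≤∣p-y∣ (x∈p⇒∣p-x∣<∣p∣ y∈p)) ∣p∣≤1)
    where
    1≤∣p-y∣ : 1 ≤ ∣ p - y ∣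
    1≤∣p-y∣ = ℕ.<-≤-trans (s≤s z≤n)
      (x∈p⇒∣p-x∣<∣p∣ (x∈p∧x≢y⇒x∈p-y x∈p λ x≡y → y≢x (≡.sym x≡y)))

  module _ {n : ℕ} where

    adj⇒≢ : (H : Graph n) {u w : Fin n} → adj H u w ≡ true → u ≢ w
    adj⇒≢ H {u} uw refl with () ← trans (≡.sym uw) (irrefl H u)

    adj⇒∈nbhd : (H : Graph n) {v x : Fin n} → adj H v x ≡ true → x ∈ nbhd H v
    adj⇒∈nbhd H {v} {x} vx =
      Vec.lookup⇒[]= x (tabulate (adj H v)) (trans (Vec.lookup∘tabulate (adj H v) x) vx)

    ∈nbhd⇒adj : (H : Graph n) {v x : Fin n} → x ∈ nbhd H v → adj H v x ≡ true
    ∈nbhd⇒adj H {v} {x} x∈N = trans (≡.sym (Vec.lookup∘tabulate (adj H v) x)) (Vec.[]=⇒lookup x∈N)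

    -- The six adjacencies already force a, b, c, d to be distinct.
    P4-free : (H : Graph n) → IsCograph H → ∀ {a b c d} →
              adj H a b ≡ true → adj H b c ≡ true → adj H c d ≡ true →
              adj H a c ≡ false → adj H b d ≡ false → adj H a d ≡ false → ⊥
    P4-free H cog {a} {b} {c} {d} ab bc cd ac bd ad = cog a b c d
      ( adj⇒≢ H ab , a≢c , a≢d , adj⇒≢ H bc , b≢d , adj⇒≢ H cd
      , ab , bc , cd , ac , bd , ad )
      where
      a≢c : a ≢ c
      a≢c refl with () ← trans (≡.sym cd) ad
      b≢d : b ≢ d
      b≢d refl with () ← trans (≡.sym ab) ad
      a≢d : a ≢ d
      a≢d refl with () ← trans (≡.sym cd) (trans (Graph.sym H c a) ac)

    P4-free⇒¬adj : (H : Graph n) → IsCograph H → ∀ {v t y u} →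
                   adj H v t ≡ true → adj H v y ≡ true → adj H v u ≡ false →
                   adj H y t ≡ false → adj H u t ≡ false → adj H y u ≡ false
    P4-free⇒¬adj H cog {v} {t} {y} {u} vt vy vu yt ut with adj H y u in yu
    ... | false = refl
    ... | true  = ⊥-elim (P4-free H cog (trans (Graph.sym H u y) yu) (trans (Graph.sym H y v) vy) vt
                                        (trans (Graph.sym H u v) vu) yt ut)

    module _ (G : Graph n) where

      adj⇒¬adjᶜ : ∀ {u w} → adj G u w ≡ true → adj (complement G) u w ≡ false
      adj⇒¬adjᶜ uw rewrite uw = ∧-zeroʳ _

      adjᶜ⇒¬adj : ∀ {u w} → adj (complement G) u w ≡ true → adj G u w ≡ false
      adjᶜ⇒¬adj {u} {w} uw with adj G u w
      ... | false = refl
      ... | true  with () ← trans (≡.sym uw) (∧-zeroʳ _)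

      ¬adjᶜ⇒adj : ∀ {u w} → u ≢ w → adj (complement G) u w ≡ false → adj G u w ≡ true
      ¬adjᶜ⇒adj {u} {w} u≢w uw with u ≟ w | adj G u w
      ... | yes u≡w | _     = ⊥-elim (u≢w u≡w)
      ... | no  _   | true  = refl

      -- P4 is self-complementary: the complement of the path a-b-c-d is the path c-a-d-b.
      complement-isCograph : IsCograph G → IsCograph (complement G)
      complement-isCograph cog a b c d (_ , a≢c , a≢d , _ , b≢d , _ , ab , bc , cd , ac , bd , ad) =
        P4-free G cog
          (¬adjᶜ⇒adj (λ c≡a → a≢c (≡.sym c≡a)) (trans (Graph.sym (complement G) c a) ac))
          (¬adjᶜ⇒adj a≢d ad)
          (¬adjᶜ⇒adj (λ d≡b → b≢d (≡.sym d≡b)) (trans (Graph.sym (complement G) d b) bd))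
          (adjᶜ⇒¬adj cd) (adjᶜ⇒¬adj ab) (adjᶜ⇒¬adj (trans (Graph.sym (complement G) c b) bc))

    module _ (H : Graph n) {v x : Fin n} {X : Subset n} where

      ∈∩nbhd⁺ : x ∈ X → adj H v x ≡ true → x ∈ X ∩ nbhd H v
      ∈∩nbhd⁺ x∈X vx = x∈p∩q⁺ (x∈X , adj⇒∈nbhd H vx)

      ∈∩nbhd⁻ : x ∈ X ∩ nbhd H v → x ∈ X × adj H v x ≡ true
      ∈∩nbhd⁻ x∈ = let x∈X , x∈N = x∈p∩q⁻ X _ x∈ in x∈X , ∈nbhd⇒adj H x∈N

      ∈∩∁nbhd⁺ : x ∈ X → adj H v x ≡ false → x ∈ X ∩ ∁ (nbhd H v)
      ∈∩∁nbhd⁺ x∈X vx = x∈p∩q⁺ (x∈X , x∉p⇒x∈∁p λ x∈N → Bool.not-¬ vx (∈nbhd⇒adj H x∈N))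

      ∈∩∁nbhd⁻ : x ∈ X ∩ ∁ (nbhd H v) → x ∈ X × adj H v x ≡ false
      ∈∩∁nbhd⁻ x∈ =
        let x∈X , x∈∁N = x∈p∩q⁻ X _ x∈ in
        x∈X , ¬-not λ vx → x∈∁p⇒x∉p x∈∁N (adj⇒∈nbhd H vx)

    search : (X : Subset n) (f : Fin n → Bool) (b : Bool) →
             (∃ λ w → w ∈ X × f w ≡ b) ⊎ (∀ {w} → w ∈ X → f w ≡ not b)
    search X f b with Fin.any? (λ w → w ∈? X ×-dec f w Bool.≟ b)
    ... | yes found = inj₁ found
    ... | no  none  = inj₂ λ {w} w∈X → ¬-not λ fw≡b → none (w , w∈X , fw≡b)

    Anticomplete : Graph n → Subset n → Subset n → Set
    Anticomplete H X Y = ∀ {u w} → u ∈ X → w ∈ Y → adj H u w ≡ false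

    module _ (H : Graph n) where

      anticomplete-sym : ∀ {X Y} → Anticomplete H X Y → Anticomplete H Y X
      anticomplete-sym XY {u} {w} u∈Y w∈X = trans (Graph.sym H u w) (XY w∈X u∈Y)

      anticomplete-⊆ : ∀ {X X' Y Y'} → X' ⊆ X → Y' ⊆ Y → Anticomplete H X Y → Anticomplete H X' Y'
      anticomplete-⊆ X'⊆X Y'⊆Y XY u∈X' w∈Y' = XY (X'⊆X u∈X') (Y'⊆Y w∈Y')

      anticomplete-∪ : ∀ {X Y Z} → Anticomplete H X Z → Anticomplete H Y Z → Anticomplete H (X ∪ Y) Z
      anticomplete-∪ {X} {Y} XZ YZ u∈X∪Y w∈Z =
        [ (λ u∈X → XZ u∈X w∈Z) , (λ u∈Y → YZ u∈Y w∈Z) ]′ (x∈p∪q⁻ X Y u∈X∪Y)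

      anticomplete-⁅⁆ : ∀ {v Y} → (∀ {w} → w ∈ Y → adj H v w ≡ false) → Anticomplete H ⁅ v ⁆ Y
      anticomplete-⁅⁆ {v} v-isolated u∈⁅v⁆ w∈Y rewrite x∈⁅y⁆⇒x≡y v u∈⁅v⁆ = v-isolated w∈Y

    record Split (H : Graph n) (S : Subset n) : Set where
      field
        A B          : Subset n
        A⊆S          : A ⊆ S
        B⊆S          : B ⊆ S
        cover        : ∀ {x} → x ∈ S → x ∈ A ⊎ x ∈ B
        disjoint     : ∀ {x} → x ∈ A → x ∉ B
        A-nonempty   : Nonempty A
        B-nonempty   : Nonempty B
        anticomplete : Anticomplete H A B

    Split-swap : ∀ {H S} → Split H S → Split H S
    Split-swap {H} sp = record
      { A = B ; B = A ; A⊆S = B⊆S ; B⊆S = A⊆S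
      ; cover = λ x∈S → Sum.swap (cover x∈S)
      ; disjoint = λ x∈B x∈A → disjoint x∈A x∈B
      ; A-nonempty = B-nonempty ; B-nonempty = A-nonempty
      ; anticomplete = anticomplete-sym H anticomplete
      }
      where open Split sp

    module Extension {H H' : Graph n} (H-cograph : IsCograph H)
                     (exclusive : ∀ {u w} → adj H u w ≡ true → adj H' u w ≡ false)
                     {S : Subset n} {v : Fin n} (v∈S : v ∈ S) where

      S-v⊆S : S - v ⊆ S
      S-v⊆S = p─q⊆p S ⁅ v ⁆

      ⁅v⁆⊆S : ⁅ v ⁆ ⊆ S
      ⁅v⁆⊆S x∈⁅v⁆ rewrite x∈⁅y⁆⇒x≡y v x∈⁅v⁆ = v∈S

      v-or-S-v : ∀ {x} → x ∈ S → x ∈ ⁅ v ⁆ ⊎ x ∈ S - v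
      v-or-S-v {x} x∈S with x ≟ v
      ... | yes refl = inj₁ (x∈⁅x⁆ v)
      ... | no  x≢v  = inj₂ (x∈p∧x≢y⇒x∈p-y x∈S x≢v)

      ⁅v⁆-disjoint : ∀ {x} → x ∈ ⁅ v ⁆ → x ∉ S - v
      ⁅v⁆-disjoint x∈⁅v⁆ x∈S-v = x∈p-y⇒x≢y S x∈S-v (x∈⁅y⁆⇒x≡y v x∈⁅v⁆)

      isolate : ∀ {K} → (∀ {w} → w ∈ S - v → adj K v w ≡ false) → Nonempty (S - v) → Split K S
      isolate {K} v-isolated S-v-nonempty = record
        { A = ⁅ v ⁆ ; B = S - v ; A⊆S = ⁅v⁆⊆S ; B⊆S = S-v⊆S
        ; cover = v-or-S-v ; disjoint = ⁅v⁆-disjoint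
        ; A-nonempty = v , x∈⁅x⁆ v ; B-nonempty = S-v-nonempty
        ; anticomplete = anticomplete-⁅⁆ K v-isolated
        }

      module _ (sp : Split H (S - v)) where
        open Split sp

        attach : (∀ {w} → w ∈ B → adj H v w ≡ false) → Split H S
        attach v-isolated = record
          { A = A ∪ ⁅ v ⁆ ; B = B
          ; A⊆S = p∪q⊆r (λ x∈A → S-v⊆S (A⊆S x∈A)) ⁅v⁆⊆S
          ; B⊆S = λ x∈B → S-v⊆S (B⊆S x∈B)
          ; cover = λ x∈S → [ (λ x∈⁅v⁆ → inj₁ (x∈p∪q⁺ (inj₂ x∈⁅v⁆)))
                            , (λ x∈S-v → Sum.map₁ (λ x∈A → x∈p∪q⁺ (inj₁ x∈A)) (cover x∈S-v)) ]′
                            (v-or-S-v x∈S)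
          ; disjoint = λ x∈A∪⁅v⁆ x∈B → [ (λ x∈A → disjoint x∈A x∈B)
                                       , (λ x∈⁅v⁆ → ⁅v⁆-disjoint x∈⁅v⁆ (B⊆S x∈B)) ]′
                                       (x∈p∪q⁻ A ⁅ v ⁆ x∈A∪⁅v⁆)
          ; A-nonempty = let x , x∈A = A-nonempty in x , x∈p∪q⁺ (inj₁ x∈A)
          ; B-nonempty = B-nonempty
          ; anticomplete = anticomplete-∪ H anticomplete (anticomplete-⁅⁆ H v-isolated)
          }

        -- If v sees both parts but not all of S - v, then S splits into the closed neighbourhood
        -- of v and the rest: an edge from a neighbour y to a non-neighbour u of v inside one part
        -- would close the induced path u-y-v-r, with r a neighbour of v in the other part.
        module _ {r r' : Fin n} (r∈A : r ∈ A) (vr : adj H v r ≡ true)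
                 (r'∈B : r' ∈ B) (vr' : adj H v r' ≡ true) where

          neighbours-anticomplete : Anticomplete H ((S - v) ∩ nbhd H v) ((S - v) ∩ ∁ (nbhd H v))
          neighbours-anticomplete y∈ u∈
            with y∈S-v , vy ← ∈∩nbhd⁻ H y∈ | u∈S-v , vu ← ∈∩∁nbhd⁻ H u∈
            with cover y∈S-v | cover u∈S-v
          ... | inj₁ y∈A | inj₁ u∈A =
                P4-free⇒¬adj H H-cograph vr' vy vu (anticomplete y∈A r'∈B) (anticomplete u∈A r'∈B)
          ... | inj₂ y∈B | inj₂ u∈B =
                P4-free⇒¬adj H H-cograph vr vy vu
                  (anticomplete-sym H anticomplete y∈B r∈A) (anticomplete-sym H anticomplete u∈B r∈A)
          ... | inj₁ y∈A | inj₂ u∈B = anticomplete y∈A u∈B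
          ... | inj₂ y∈B | inj₁ u∈A = anticomplete-sym H anticomplete y∈B u∈A

          by-neighbourhood : ∀ {w} → w ∈ S - v → adj H v w ≡ false → Split H S
          by-neighbourhood {w} w∈S-v vw = record
            { A = N ∪ ⁅ v ⁆ ; B = Z
            ; A⊆S = p∪q⊆r (λ x∈N → S-v⊆S (proj₁ (∈∩nbhd⁻ H x∈N))) ⁅v⁆⊆S
            ; B⊆S = λ x∈Z → S-v⊆S (proj₁ (∈∩∁nbhd⁻ H x∈Z))
            ; cover = λ x∈S → [ (λ x∈⁅v⁆ → inj₁ (x∈p∪q⁺ (inj₂ x∈⁅v⁆))) , cover-S-v ]′ (v-or-S-v x∈S)
            ; disjoint = λ x∈N∪⁅v⁆ x∈Z →
                [ (λ x∈N → Bool.not-¬ (proj₂ (∈∩nbhd⁻ H x∈N)) (proj₂ (∈∩∁nbhd⁻ H x∈Z)))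
                , (λ x∈⁅v⁆ → ⁅v⁆-disjoint x∈⁅v⁆ (proj₁ (∈∩∁nbhd⁻ H x∈Z))) ]′
                (x∈p∪q⁻ N ⁅ v ⁆ x∈N∪⁅v⁆)
            ; A-nonempty = v , x∈p∪q⁺ (inj₂ (x∈⁅x⁆ v))
            ; B-nonempty = w , ∈∩∁nbhd⁺ H w∈S-v vw
            ; anticomplete = anticomplete-∪ H neighbours-anticomplete
                               (anticomplete-⁅⁆ H λ x∈Z → proj₂ (∈∩∁nbhd⁻ H x∈Z))
            }
            where
            N Z : Subset n
            N = (S - v) ∩ nbhd H v
            Z = (S - v) ∩ ∁ (nbhd H v)
            cover-S-v : ∀ {x} → x ∈ S - v → x ∈ N ∪ ⁅ v ⁆ ⊎ x ∈ Z
            cover-S-v {x} x∈S-v with adj H v x in vx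
            ... | true  = inj₁ (x∈p∪q⁺ (inj₁ (∈∩nbhd⁺ H x∈S-v vx)))
            ... | false = inj₂ (∈∩∁nbhd⁺ H x∈S-v vx)

      extend : Split H (S - v) → Split H S ⊎ Split H' S
      extend sp with search (Split.B sp) (adj H v) true
      ... | inj₂ B-isolated = inj₁ (attach sp B-isolated)
      ... | inj₁ (r' , r'∈B , vr') with search (Split.A sp) (adj H v) true
      ...   | inj₂ A-isolated = inj₁ (attach (Split-swap sp) A-isolated)
      ...   | inj₁ (r , r∈A , vr) with search (S - v) (adj H v) false
      ...     | inj₂ v-universal =
                  inj₂ (isolate (λ w∈S-v → exclusive (v-universal w∈S-v)) (r' , Split.B⊆S sp r'∈B))
      ...     | inj₁ (w , w∈S-v , vw) = inj₁ (by-neighbourhood sp r∈A vr r'∈B vr' w∈S-v vw)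

      isolate-only : ∀ {K a} → ∣ S - v ∣ ≤ 1 → a ∈ S - v → adj K v a ≡ false → Split K S
      isolate-only {K} ∣S-v∣≤1 a∈S-v va = isolate v-isolated (_ , a∈S-v)
        where
        v-isolated : ∀ {w} → w ∈ S - v → adj K v w ≡ false
        v-isolated w∈S-v rewrite ∣p∣≤1⇒unique ∣S-v∣≤1 a∈S-v w∈S-v = va

      extend-singleton : ∣ S - v ∣ ≤ 1 → Nonempty (S - v) → Split H S ⊎ Split H' S
      extend-singleton ∣S-v∣≤1 (a , a∈S-v) with adj H v a in va
      ... | false = inj₁ (isolate-only ∣S-v∣≤1 a∈S-v va)
      ... | true  = inj₂ (isolate-only ∣S-v∣≤1 a∈S-v (exclusive va))

    cograph-split : {G : Graph n} → IsCograph G → ∀ S → 2 ≤ ∣ S ∣ → Split G S ⊎ Split (complement G) S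
    cograph-split {G} cog S = go S (<-wellFounded ∣ S ∣)
      where
      go : ∀ S → Acc _<_ ∣ S ∣ → 2 ≤ ∣ S ∣ → Split G S ⊎ Split (complement G) S
      go S (acc rec) 2≤∣S∣ with ∣p∣>0⇒Nonempty S (ℕ.<-trans (s≤s z≤n) 2≤∣S∣)
      ... | v , v∈S with 2 ≤? ∣ S - v ∣
      ...   | yes 2≤∣S-v∣ =
                [ ExtG.extend , (λ sp → Sum.swap (ExtGᶜ.extend sp)) ]′
                (go (S - v) (rec (x∈p⇒∣p-x∣<∣p∣ v∈S)) 2≤∣S-v∣)
        where
        module ExtG  = Extension cog (adj⇒¬adjᶜ G) v∈S
        module ExtGᶜ = Extension (complement-isCograph G cog) (adjᶜ⇒¬adj G) v∈S
      ...   | no  2≰∣S-v∣ = extend-singleton ∣S-v∣≤1 (∣p∣>0⇒Nonempty (S - v) ∣S-v∣>0)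
        where
        open Extension cog (adj⇒¬adjᶜ G) v∈S using (v-or-S-v; extend-singleton)
        ∣S-v∣≤1 : ∣ S - v ∣ ≤ 1
        ∣S-v∣≤1 = ℕ.≤-pred (ℕ.≰⇒> 2≰∣S-v∣)
        ∣S∣≤1+∣S-v∣ : ∣ S ∣ ≤ 1 + ∣ S - v ∣
        ∣S∣≤1+∣S-v∣ = subst (λ k → ∣ S ∣ ≤ k + ∣ S - v ∣) (∣⁅x⁆∣≡1 v) (∣p∣≤∣q∣+∣r∣ v-or-S-v)
        ∣S-v∣>0 : 0 < ∣ S - v ∣
        ∣S-v∣>0 = ℕ.≤-pred (ℕ.≤-trans 2≤∣S∣ ∣S∣≤1+∣S-v∣)

    MaxDegAtMost : Graph n → Subset n → ℕ → Set
    MaxDegAtMost H X D = ∀ {v} → v ∈ X → degIn H X v ≤ D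

    module _ (H : Graph n) where

      degIn<∣X∣ : ∀ {X v} → v ∈ X → degIn H X v < ∣ X ∣
      degIn<∣X∣ {X} {v} v∈X = ℕ.≤-<-trans (p⊆q⇒∣p∣≤∣q∣ X∩N⊆X-v) (x∈p⇒∣p-x∣<∣p∣ v∈X)
        where
        X∩N⊆X-v : X ∩ nbhd H v ⊆ X - v
        X∩N⊆X-v x∈ = let x∈X , vx = ∈∩nbhd⁻ H x∈ in x∈p∧x≢y⇒x∈p-y x∈X λ x≡v → adj⇒≢ H vx (≡.sym x≡v)

      small⇒MaxDegAtMost : ∀ {X D} → ∣ X ∣ ≤ suc D → MaxDegAtMost H X D
      small⇒MaxDegAtMost ∣X∣≤1+D v∈X = ℕ.≤-pred (ℕ.<-≤-trans (degIn<∣X∣ v∈X) ∣X∣≤1+D)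

      ∪∩nbhd⊆∩nbhd : ∀ {X Y v} → Anticomplete H X Y → v ∈ X → (X ∪ Y) ∩ nbhd H v ⊆ X ∩ nbhd H v
      ∪∩nbhd⊆∩nbhd {X} {Y} XY v∈X x∈ with x∈X∪Y , vx ← ∈∩nbhd⁻ H x∈ with x∈p∪q⁻ X Y x∈X∪Y
      ... | inj₁ x∈X = ∈∩nbhd⁺ H x∈X vx
      ... | inj₂ x∈Y = ⊥-elim (Bool.not-¬ (XY v∈X x∈Y) vx)

      MaxDegAtMost-∪ : ∀ {X Y D} → Anticomplete H X Y →
                       MaxDegAtMost H X D → MaxDegAtMost H Y D → MaxDegAtMost H (X ∪ Y) D
      MaxDegAtMost-∪ {X} {Y} XY X-sparse Y-sparse {v} v∈X∪Y with x∈p∪q⁻ X Y v∈X∪Y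
      ... | inj₁ v∈X = ℕ.≤-trans (p⊆q⇒∣p∣≤∣q∣ (∪∩nbhd⊆∩nbhd XY v∈X)) (X-sparse v∈X)
      ... | inj₂ v∈Y rewrite ∪-comm X Y =
            ℕ.≤-trans (p⊆q⇒∣p∣≤∣q∣ (∪∩nbhd⊆∩nbhd (anticomplete-sym H XY) v∈Y)) (Y-sparse v∈Y)

    Large : ℕ → Subset n → Subset n → Subset n → Set
    Large D S P Q = ∣ S ∣ + ∣ S ∣ ⊓ suc D ≤ ∣ P ∣ + ∣ Q ∣ ⊎ suc D + suc D ≤ ∣ P ∣ ⊎ suc D + suc D ≤ ∣ Q ∣

    record SparsePair (H H' : Graph n) (D : ℕ) (S : Subset n) : Set where
      field
        P Q      : Subset n
        P⊆S      : P ⊆ S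
        Q⊆S      : Q ⊆ S
        P-sparse : MaxDegAtMost H P D
        Q-sparse : MaxDegAtMost H' Q D
        large    : Large D S P Q

    SparsePair-swap : ∀ {H H' D S} → SparsePair H H' D S → SparsePair H' H D S
    SparsePair-swap {D = D} {S} pair = record
      { P = Q ; Q = P ; P⊆S = Q⊆S ; Q⊆S = P⊆S ; P-sparse = Q-sparse ; Q-sparse = P-sparse
      ; large = swap-large large
      }
      where
      open SparsePair pair
      swap-large : Large D S P Q → Large D S Q P
      swap-large (inj₁ sum)        = inj₁ (subst (∣ S ∣ + ∣ S ∣ ⊓ suc D ≤_) (ℕ.+-comm ∣ P ∣ ∣ Q ∣) sum)
      swap-large (inj₂ (inj₁ big)) = inj₂ (inj₂ big)
      swap-large (inj₂ (inj₂ big)) = inj₂ (inj₁ big)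

    ∣A∣<∣S∣ : ∀ {H S} (sp : Split H S) → ∣ Split.A sp ∣ < ∣ S ∣
    ∣A∣<∣S∣ sp =
      let b , b∈B = B-nonempty in p⊂q⇒∣p∣<∣q∣ (A⊆S , b , B⊆S b∈B , λ b∈A → disjoint b∈A b∈B)
      where open Split sp

    module _ (H H' : Graph n) (D : ℕ) where

      by-size : ∀ {S P} → P ⊆ S → ∣ S ∣ ≤ ∣ P ∣ → MaxDegAtMost H P D → SparsePair H H' D S
      by-size {S} {P} P⊆S ∣S∣≤∣P∣ P-sparse with ∃⊆-ofSize S (∣ S ∣ ⊓ suc D) (ℕ.m⊓n≤m ∣ S ∣ (suc D))
      ... | Q , Q⊆S , ∣Q∣≡∣S∣⊓b = record
        { P = P ; Q = Q ; P⊆S = P⊆S ; Q⊆S = Q⊆S ; P-sparse = P-sparse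
        ; Q-sparse = small⇒MaxDegAtMost H' (subst (_≤ suc D) (≡.sym ∣Q∣≡∣S∣⊓b) (ℕ.m⊓n≤n ∣ S ∣ (suc D)))
        ; large = inj₁ (ℕ.+-mono-≤ ∣S∣≤∣P∣ (ℕ.≤-reflexive (≡.sym ∣Q∣≡∣S∣⊓b)))
        }

      both-large : ∀ {S} (sp : Split H S) → suc D ≤ ∣ Split.A sp ∣ → suc D ≤ ∣ Split.B sp ∣ →
                   SparsePair H H' D S
      both-large sp bigA bigB
        with ∃⊆-ofSize (Split.A sp) (suc D) bigA | ∃⊆-ofSize (Split.B sp) (suc D) bigB
      ... | X , X⊆A , ∣X∣≡b | Y , Y⊆B , ∣Y∣≡b = record
        { P = X ∪ Y ; Q = ∅ ; P⊆S = p∪q⊆r (A⊆S ∘ X⊆A) (B⊆S ∘ Y⊆B) ; Q⊆S = ⊥⊆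
        ; P-sparse = MaxDegAtMost-∪ H (anticomplete-⊆ H X⊆A Y⊆B anticomplete)
                       (small⇒MaxDegAtMost H (ℕ.≤-reflexive ∣X∣≡b))
                       (small⇒MaxDegAtMost H (ℕ.≤-reflexive ∣Y∣≡b))
        ; Q-sparse = λ v∈∅ → ⊥-elim (∉⊥ v∈∅)
        ; large = inj₂ (inj₁ (ℕ.≤-reflexive (≡.sym ∣X∪Y∣≡2b)))
        }
        where
        open Split sp
        ∣X∪Y∣≡2b : ∣ X ∪ Y ∣ ≡ suc D + suc D
        ∣X∪Y∣≡2b = trans (∣p∪q∣≡∣p∣+∣q∣ X Y λ x∈X x∈Y → disjoint (X⊆A x∈X) (Y⊆B x∈Y))
                         (cong₂ _+_ ∣X∣≡b ∣Y∣≡b)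

      grow : ∀ {S} (sp : Split H S) → suc D ≤ ∣ Split.A sp ∣ → ∣ Split.B sp ∣ ≤ suc D →
             SparsePair H H' D (Split.A sp) → SparsePair H H' D S
      grow {S} sp bigA smallB pair = record
        { P = P ∪ B ; Q = Q ; P⊆S = p∪q⊆r (A⊆S ∘ P⊆A) B⊆S ; Q⊆S = A⊆S ∘ Q⊆A
        ; P-sparse = MaxDegAtMost-∪ H (anticomplete-⊆ H P⊆A ⊆-refl anticomplete)
                       P-sparse (small⇒MaxDegAtMost H smallB)
        ; Q-sparse = Q-sparse
        ; large = grow-large large
        }
        where
        open Split sp
        open SparsePair pair renaming (P⊆S to P⊆A; Q⊆S to Q⊆A)
        open ℕ.≤-Reasoning
        grow-large : Large D A P Q → Large D S (P ∪ B) Q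
        grow-large (inj₁ sum) = inj₁ (begin
          ∣ S ∣ + ∣ S ∣ ⊓ suc D         ≤⟨ ℕ.+-mono-≤ (∣p∣≤∣q∣+∣r∣ cover) (ℕ.m⊓n≤n ∣ S ∣ (suc D)) ⟩
          ∣ A ∣ + ∣ B ∣ + suc D         ≡⟨ xy∙z≈xz∙y (∣ A ∣) (∣ B ∣) (suc D) ⟩
          ∣ A ∣ + suc D + ∣ B ∣         ≡⟨ cong (λ k → ∣ A ∣ + k + ∣ B ∣) (≡.sym (ℕ.m≥n⇒m⊓n≡n bigA)) ⟩
          ∣ A ∣ + ∣ A ∣ ⊓ suc D + ∣ B ∣ ≤⟨ ℕ.+-monoˡ-≤ ∣ B ∣ sum ⟩
          ∣ P ∣ + ∣ Q ∣ + ∣ B ∣         ≡⟨ xy∙z≈xz∙y (∣ P ∣) (∣ Q ∣) (∣ B ∣) ⟩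
          ∣ P ∣ + ∣ B ∣ + ∣ Q ∣         ≡⟨ cong (_+ ∣ Q ∣) (≡.sym (∣p∪q∣≡∣p∣+∣q∣ P B (disjoint ∘ P⊆A))) ⟩
          ∣ P ∪ B ∣ + ∣ Q ∣             ∎)
        grow-large (inj₂ (inj₁ big)) = inj₂ (inj₁ (ℕ.≤-trans big (∣p∣≤∣p∪q∣ P B)))
        grow-large (inj₂ (inj₂ big)) = inj₂ (inj₂ big)

      from-split : ∀ {S} → Split H S → (∀ {T} → ∣ T ∣ < ∣ S ∣ → SparsePair H H' D T) →
                   SparsePair H H' D S
      from-split sp smaller with suc D ≤? ∣ Split.A sp ∣ | suc D ≤? ∣ Split.B sp ∣
      ... | yes bigA | yes bigB = both-large sp bigA bigB
      ... | yes bigA | no  b≰B  = grow sp bigA (ℕ.≰⇒≥ b≰B) (smaller (∣A∣<∣S∣ sp))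
      ... | no  b≰A  | yes bigB =
            grow (Split-swap sp) bigB (ℕ.≰⇒≥ b≰A) (smaller (∣A∣<∣S∣ (Split-swap sp)))
      ... | no  b≰A  | no  b≰B  =
            by-size (p∪q⊆r A⊆S B⊆S) (p⊆q⇒∣p∣≤∣q∣ (x∈p∪q⁺ ∘ cover))
                    (MaxDegAtMost-∪ H anticomplete (small⇒MaxDegAtMost H (ℕ.≰⇒≥ b≰A))
                                                   (small⇒MaxDegAtMost H (ℕ.≰⇒≥ b≰B)))
        where open Split sp

    sparse-pair : {G : Graph n} → IsCograph G → ∀ D S → SparsePair G (complement G) D S
    sparse-pair {G} cog D S = go S (<-wellFounded ∣ S ∣)
      where
      go : ∀ S → Acc _<_ ∣ S ∣ → SparsePair G (complement G) D S
      go S (acc rec) with ∣ S ∣ ≤? suc D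
      ... | yes small = by-size G (complement G) D ⊆-refl ℕ.≤-refl (small⇒MaxDegAtMost G small)
      ... | no  large with cograph-split cog S (ℕ.≤-trans (s≤s (s≤s z≤n)) (ℕ.≰⇒> large))
      ...   | inj₁ sp = from-split G (complement G) D sp (λ smaller → go _ (rec smaller))
      ...   | inj₂ sp = SparsePair-swap (from-split (complement G) G D sp
                                          (λ smaller → SparsePair-swap (go _ (rec smaller))))

open Combinatorics using (MaxDegAtMost; Large; SparsePair; sparse-pair)

open import Data.Nat using (ℕ; suc)
import Data.Nat as ℕ
import Data.Nat.Properties as ℕ
open import Data.Integer using (+_)
import Data.Integer as ℤ
import Data.Integer.Properties as ℤ
import Data.Nat.Coprimality as Coprime
open import Data.Rational using (ℚ; ½; 1ℚ; _≤_; _<_; _*_; _-_; _+_)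
open import Data.Rational using (0ℚ; mkℚ; *≤*; Positive; NonNegative; positive; nonNegative)
open import Data.Rational.Properties
open import Data.Rational.Solver using (module +-*-Solver)
open +-*-Solver using (solve; _:=_; _:+_; _:*_; _:-_; con)

toℚ≡mkℚ : ∀ k → toℚ k ≡ mkℚ (+ k) 0 (Coprime.sym (Coprime.1-coprimeTo k))
toℚ≡mkℚ k = normalize-coprime (Coprime.sym (Coprime.1-coprimeTo k))

toℚ-mono-≤ : ∀ {m n} → m ℕ.≤ n → toℚ m ≤ toℚ n
toℚ-mono-≤ {m} {n} m≤n rewrite toℚ≡mkℚ m | toℚ≡mkℚ n =
  *≤* (≡.subst₂ ℤ._≤_ (≡.sym (ℤ.*-identityʳ (+ m))) (≡.sym (ℤ.*-identityʳ (+ n))) (ℤ.+≤+ m≤n))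

toℚ-+ : ∀ m n → toℚ (m ℕ.+ n) ≡ toℚ m + toℚ n
toℚ-+ m n rewrite toℚ≡mkℚ m | toℚ≡mkℚ n =
  /-cong (trans (ℤ.pos-+ m n) (cong₂ ℤ._+_ (≡.sym (ℤ.*-identityʳ (+ m))) (≡.sym (ℤ.*-identityʳ (+ n)))))
         refl

∃-floor : ∀ {x} → 0ℚ ≤ x → ∀ M → x < toℚ M → ∃ λ D → toℚ D ≤ x × x < toℚ (suc D)
∃-floor 0≤x 0       x<0 = ⊥-elim (<-irrefl refl (≤-<-trans 0≤x x<0))
∃-floor {x} 0≤x (suc M) x<1+M with x <? toℚ M
... | yes x<M = ∃-floor 0≤x M x<M
... | no  x≮M = M , ≮⇒≥ x≮M , x<1+M

+<+⇒<⊎< : ∀ {a b p q} → a + b < p + q → a < p ⊎ b < q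
+<+⇒<⊎< {a} {b} {p} {q} a+b<p+q with a <? p | b <? q
... | yes a<p | _       = inj₁ a<p
... | no  _   | yes b<q = inj₂ b<q
... | no  a≮p | no  b≮q = ⊥-elim (<-irrefl refl (≤-<-trans (+-mono-≤ (≮⇒≥ a≮p) (≮⇒≥ b≮q)) a+b<p+q))

MaxDegAtMost⇒MaxDegInducedAtMost : ∀ {n} (H : Graph n) {X D x} →
                                   MaxDegAtMost H X D → toℚ D ≤ x → MaxDegInducedAtMost H X x
MaxDegAtMost⇒MaxDegInducedAtMost H sparse D≤x v v∈X = ≤-trans (toℚ-mono-≤ (sparse v∈X)) D≤x

module Parameters (ε δ : ℚ) (½≤ε : ½ ≤ ε) (ε<1 : ε < 1ℚ) (δ-eq : δ * ((1ℚ + 1ℚ) - ε) ≡ 1ℚ) where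

  1<2-ε : 1ℚ < (1ℚ + 1ℚ) - ε
  1<2-ε = +-monoʳ-< (1ℚ + 1ℚ) (neg-antimono-< ε<1)

  instance
    2-ε-nonNeg : NonNegative ((1ℚ + 1ℚ) - ε)
    2-ε-nonNeg = nonNegative (<⇒≤ (<-trans (positive⁻¹ 1ℚ) 1<2-ε))
    ε-nonNeg : NonNegative ε
    ε-nonNeg = nonNegative (≤-trans (nonNegative⁻¹ ½) ½≤ε)

  0<δ : 0ℚ < δ
  0<δ = *-cancelʳ-<-nonNeg ((1ℚ + 1ℚ) - ε)
          (≡.subst₂ _<_ (≡.sym (*-zeroˡ ((1ℚ + 1ℚ) - ε))) (≡.sym δ-eq) (positive⁻¹ 1ℚ))

  δ<1 : δ < 1ℚ
  δ<1 = *-cancelʳ-<-nonNeg ((1ℚ + 1ℚ) - ε)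
          (≡.subst₂ _<_ (≡.sym δ-eq) (≡.sym (*-identityˡ ((1ℚ + 1ℚ) - ε))) 1<2-ε)

  instance
    δ-pos : Positive δ
    δ-pos = positive 0<δ
    εδ-nonNeg : NonNegative (ε * δ)
    εδ-nonNeg = nonNeg*nonNeg⇒nonNeg ε δ {{pos⇒nonNeg δ}}

  module _ (n : ℕ) where

    N : ℚ
    N = toℚ (suc n)

    instance
      N-pos : Positive N
      N-pos = positive (<-≤-trans (positive⁻¹ 1ℚ) (toℚ-mono-≤ {1} {suc n} (ℕ.s≤s ℕ.z≤n)))
      δN-pos : Positive (δ * N)
      δN-pos = pos*pos⇒pos δ N

    0≤εδN : 0ℚ ≤ ε * δ * N
    0≤εδN = nonNegative⁻¹ (ε * δ * N) {{nonNeg*nonNeg⇒nonNeg (ε * δ) N {{pos⇒nonNeg N}}}}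

    εδN<N : ε * δ * N < N
    εδN<N = begin-strict
      ε * δ * N    ≡⟨ *-assoc ε δ N ⟩
      ε * (δ * N)  <⟨ *-monoˡ-<-pos (δ * N) ε<1 ⟩
      1ℚ * (δ * N) ≡⟨ *-identityˡ (δ * N) ⟩
      δ * N        <⟨ *-monoˡ-<-pos N δ<1 ⟩
      1ℚ * N       ≡⟨ *-identityˡ N ⟩
      N            ∎
      where open ≤-Reasoning

    δN+δN≡N+εδN : δ * N + δ * N ≡ N + ε * δ * N
    δN+δN≡N+εδN = begin
      δ * N + δ * N
        ≡⟨ solve 3 (λ d e m → d :* m :+ d :* m := d :* (con 1ℚ :+ con 1ℚ :- e) :* m :+ e :* d :* m)
                   refl δ ε N ⟩
      δ * ((1ℚ + 1ℚ) - ε) * N + ε * δ * N  ≡⟨ cong₂ _+_ (≡.cong (_* N) δ-eq) refl ⟩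
      1ℚ * N + ε * δ * N                   ≡⟨ cong₂ _+_ (*-identityˡ N) refl ⟩
      N + ε * δ * N                        ∎
      where open ≡.≡-Reasoning

    δN≤εδN+εδN : δ * N ≤ ε * δ * N + ε * δ * N
    δN≤εδN+εδN = begin
      δ * N               ≡⟨ *-identityˡ (δ * N) ⟨
      (½ + ½) * (δ * N)   ≤⟨ *-monoʳ-≤-nonNeg (δ * N) {{pos⇒nonNeg (δ * N)}} (+-mono-≤ ½≤ε ½≤ε) ⟩
      (ε + ε) * (δ * N)   ≡⟨ solve 3 (λ e d m → (e :+ e) :* (d :* m) := e :* d :* m :+ e :* d :* m)
                                   refl ε δ N ⟩
      ε * δ * N + ε * δ * N ∎
      where open ≤-Reasoning

    δN<toℚ-of-double : ∀ b p → ε * δ * N < toℚ b → b ℕ.+ b ℕ.≤ p → δ * N < toℚ p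
    δN<toℚ-of-double b p εδN<b 2b≤p = begin-strict
      δ * N                 ≤⟨ δN≤εδN+εδN ⟩
      ε * δ * N + ε * δ * N <⟨ +-mono-< εδN<b εδN<b ⟩
      toℚ b + toℚ b         ≡⟨ toℚ-+ b b ⟨
      toℚ (b ℕ.+ b)         ≤⟨ toℚ-mono-≤ 2b≤p ⟩
      toℚ p                 ∎
      where open ≤-Reasoning

    δN<toℚ-of-sum : ∀ b p q → ε * δ * N < toℚ b → suc n ℕ.+ suc n ℕ.⊓ b ℕ.≤ p ℕ.+ q →
                    δ * N < toℚ p ⊎ δ * N < toℚ q
    δN<toℚ-of-sum b p q εδN<b N+N⊓b≤p+q = +<+⇒<⊎< (begin-strict
      δ * N + δ * N               ≡⟨ δN+δN≡N+εδN ⟩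
      N + ε * δ * N               <⟨ +-monoʳ-< N εδN<N⊓b ⟩
      N + toℚ (suc n ℕ.⊓ b)       ≡⟨ toℚ-+ (suc n) (suc n ℕ.⊓ b) ⟨
      toℚ (suc n ℕ.+ suc n ℕ.⊓ b) ≤⟨ toℚ-mono-≤ N+N⊓b≤p+q ⟩
      toℚ (p ℕ.+ q)               ≡⟨ toℚ-+ p q ⟩
      toℚ p + toℚ q               ∎)
      where
      open ≤-Reasoning
      εδN<N⊓b : ε * δ * N < toℚ (suc n ℕ.⊓ b)
      εδN<N⊓b with ℕ.⊓-sel (suc n) b
      ... | inj₁ N⊓b≡N rewrite N⊓b≡N = εδN<N
      ... | inj₂ N⊓b≡b rewrite N⊓b≡b = εδN<b

    module _ {G : Graph (suc n)} {D : ℕ}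
             (D≤εδN : toℚ D ≤ ε * δ * N) (εδN<1+D : ε * δ * N < toℚ (suc D))
             (pair : SparsePair G (complement G) D ⊤) where
      open SparsePair pair

      large-part : δ * N < toℚ ∣ P ∣ ⊎ δ * N < toℚ ∣ Q ∣
      large-part with large
      ... | inj₁ sum = δN<toℚ-of-sum (suc D) ∣ P ∣ ∣ Q ∣ εδN<1+D
                         (≡.subst (λ k → k ℕ.+ k ℕ.⊓ suc D ℕ.≤ ∣ P ∣ ℕ.+ ∣ Q ∣) (∣⊤∣≡n (suc n)) sum)
      ... | inj₂ (inj₁ big) = inj₁ (δN<toℚ-of-double (suc D) ∣ P ∣ εδN<1+D big)
      ... | inj₂ (inj₂ big) = inj₂ (δN<toℚ-of-double (suc D) ∣ Q ∣ εδN<1+D big)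

      large-sparse-set : Σ (Subset (suc n)) λ X → (δ * N < toℚ ∣ X ∣) ×
                           (MaxDegInducedAtMost G X (ε * δ * N)
                             ⊎ MaxDegInducedAtMost (complement G) X (ε * δ * N))
      large-sparse-set with large-part
      ... | inj₁ big = P , big , inj₁ (MaxDegAtMost⇒MaxDegInducedAtMost G P-sparse D≤εδN)
      ... | inj₂ big =
            Q , big , inj₂ (MaxDegAtMost⇒MaxDegInducedAtMost (complement G) Q-sparse D≤εδN)

mainTheorem10 : (ε δ : ℚ) → ½ ≤ ε → ε < 1ℚ → δ * ((1ℚ + 1ℚ) - ε) ≡ 1ℚ →
    (n : ℕ) → (G : Graph (suc n)) → IsCograph G →
    Σ (Subset (suc n)) λ X →
      (δ * toℚ (suc n) < toℚ ∣ X ∣) ×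
      (MaxDegInducedAtMost G X (ε * δ * toℚ (suc n))
        ⊎ MaxDegInducedAtMost (complement G) X (ε * δ * toℚ (suc n)))
mainTheorem10 ε δ ½≤ε ε<1 δ-eq n G cog =
  let D , D≤εδN , εδN<1+D = ∃-floor (0≤εδN n) (suc n) (εδN<N n) in
  large-sparse-set n {G} D≤εδN εδN<1+D (sparse-pair cog D ⊤)
  where open Parameters ε δ ½≤ε ε<1 δ-eq
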